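{- Let $G$ be a connected graph with at least two vertices and maximum degree at least $3$. Then every automorphism $g$ of $Y(G)$ is same-color-preserving: whenever vertices $x,y$ of $Y(G)$ have the same color in $X(G)$, then $g(x)$ and $g(y)$ have the same color in $X(G)$. The same holds for every automorphism of $\tilde Y(G)$ with respect to the coloring of $\tilde X(G)$.
   Context: For each vertex $u$ of $G$ let $A(u)=\{a(u,v): uv\in E(G)\}$ and $B(u)=\{b(u,v): uv\in E(G)\}$ be sets of new pairwise distinct elements, and let $M(u)$ be the set of all subsets of $A(u)$ of even cardinality, each regarded as a new vertex (middle vertices). The gadget $Y(u)$ has vertex set $A(u)\cup B(u)\cup M(u)$ and, for $m\in M(u)$, the edge $\{a(u,v),m\}$ if $a(u,v)\in m$ and the edge $\{b(u,v),m\}$ if $a(u,v)\notin m$. $Y(G)$ is the disjoint union of all gadgets together with, for each edge $uv\in E(G)$, the edges $\{a(u,v),a(v,u)\}$ and $\{b(u,v),b(v,u)\}$; $\tilde Y(G)$ is obtained by choosing one edge $u_0v_0$ of $G$ and replacing those two edges by $\{a(u_0,v_0),b(v_0,u_0)\}$, $\{b(u_0,v_0),a(v_0,u_0)\}$. $X(G)$ (resp. $\tilde X(G)$) is $Y(G)$ (resp. $\tilde Y(G)$) colored so that two vertices $x,y$ have the same color iff they lie in the same gadget $Y(u)$ and either $x=y$, or both are middle vertices, or $\{x,y\}=\{a(u,v),b(u,v)\}$ for some $v$. -}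

module Defs where

open import Data.Nat using (ℕ; _%_; _≡ᵇ_)
open import Data.Bool using (Bool; true; false; T; not; _∧_; _∨_)
open import Data.Fin using (Fin; _≟_)
open import Data.Fin.Subset using (Subset; _∈_; _∉_; ∣_∣; inside; outside)
open import Data.Fin.Subset.Properties using (_⊆?_)
open import Data.Vec using (tabulate)
open import Data.Maybe using (Maybe; just; nothing)
open import Data.Product using (_×_; _,_)
open import Data.Empty using (⊥)
open import Relation.Nullary.Decidable using (does)
open import Relation.Binary.PropositionalEquality using (_≡_)

record Graph (n : ℕ) : Set where
  field
    adj    : Fin n → Fin n → Bool
    sym    : ∀ u v → adj u v ≡ adj v u
    irrefl : ∀ u → adj u u ≡ false

module _ {n : ℕ} (G : Graph n) where
  open Graph G

  Adj : Fin n → Fin n → Set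
  Adj u v = T (adj u v)

  nbhd : Fin n → Subset n
  nbhd u = tabulate (λ v → adj u v)

  deg : Fin n → ℕ
  deg u = ∣ nbhd u ∣

  data Reach (u : Fin n) : Fin n → Set where
    here : Reach u u
    step : ∀ {v w} → Reach u v → Adj v w → Reach u w

  Connected : Set
  Connected = ∀ u v → Reach u v

  -- middle vertices of Y(u): even subsets of A(u), identified with even
  -- subsets m of the neighbourhood of u (a(u,v) ∈ m  iff  v ∈ m)
  validMid : Fin n → Subset n → Bool
  validMid u m = does (m ⊆? nbhd u) ∧ (∣ m ∣ % 2 ≡ᵇ 0)

  data YV : Set where
    a   : (u v : Fin n) → Adj u v → YV
    b   : (u v : Fin n) → Adj u v → YV
    mid : (u : Fin n) (m : Subset n) → T (validMid u m) → YV

  -- twisting: nothing gives Y(G); just (u₀ , v₀) gives Ỹ(G) twisted at u₀v₀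
  isTw : Maybe (Fin n × Fin n) → Fin n → Fin n → Bool
  isTw nothing _ _ = false
  isTw (just (u₀ , v₀)) u v =
    (does (u ≟ u₀) ∧ does (v ≟ v₀)) ∨ (does (u ≟ v₀) ∧ does (v ≟ u₀))

  data YEdge (t : Maybe (Fin n × Fin n)) : YV → YV → Set where
    a-m : ∀ {u v p m q} → v ∈ m → YEdge t (a u v p) (mid u m q)
    m-a : ∀ {u v p m q} → v ∈ m → YEdge t (mid u m q) (a u v p)
    b-m : ∀ {u v p m q} → v ∉ m → YEdge t (b u v p) (mid u m q)
    m-b : ∀ {u v p m q} → v ∉ m → YEdge t (mid u m q) (b u v p)
    a-a : ∀ {u v p p'} → T (not (isTw t u v)) → YEdge t (a u v p) (a v u p')
    b-b : ∀ {u v p p'} → T (not (isTw t u v)) → YEdge t (b u v p) (b v u p')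
    a-b : ∀ {u v p p'} → T (isTw t u v) → YEdge t (a u v p) (b v u p')
    b-a : ∀ {u v p p'} → T (isTw t u v) → YEdge t (b u v p) (a v u p')

  SameColor : YV → YV → Set
  SameColor (a u v _)   (a u' v' _)   = (u ≡ u') × (v ≡ v')
  SameColor (a u v _)   (b u' v' _)   = (u ≡ u') × (v ≡ v')
  SameColor (b u v _)   (a u' v' _)   = (u ≡ u') × (v ≡ v')
  SameColor (b u v _)   (b u' v' _)   = (u ≡ u') × (v ≡ v')
  SameColor (mid u _ _) (mid u' _ _)  = u ≡ u'
  SameColor _           _             = ⊥

-- In a gadget Y(u) with deg u ≥ 3 every edge at a middle vertex lies on a closed 6-walk with
-- little backtracking (a Hexagon below), whereas a cross edge between port vertices lies on none.
-- So an automorphism sends the middle vertices of such a gadget to middle vertices of one gadget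
-- Y(s), hence its port vertices to port vertices of Y(s), and a(u,v), b(u,v), which have no common
-- neighbour, to two port vertices with equal port. Along an edge uv of G this property passes from
-- Y(u) to Y(v), since each of a(v,u), b(v,u) is the unique port neighbour of a port vertex of
-- Y(u); by connectedness it holds for every gadget, and this is exactly preservation of the
-- colouring.
module Submission where

open import Defs
open import Data.Bool using (Bool; true; false; T; not; _∧_; _∨_)
open import Data.Bool.Properties
  using (not-involutive; not-¬; ¬-not; T-≡; T-not-≡; T-∧; T-irrelevant; ∧-comm; ∨-comm)
open import Data.Empty using (⊥-elim) renaming (⊥ to Empty)
open import Data.Fin using (Fin; zero; suc) renaming (_≟_ to _≟ᶠ_)
open import Data.Fin.Subset using (Subset; ⊥; _∈_; ∣_∣; _⊆_)
open import Data.Fin.Subset.Properties using (_⊆?_; ⊥⊆; ∣⊥∣≡0)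
open import Data.Maybe using (Maybe; just; nothing)
open import Data.Nat using (ℕ; zero; suc; _≤_; _%_; _≡ᵇ_; z≤n; s≤s; s≤s⁻¹)
open import Data.Nat.Properties using (≤-trans; n≤1+n)
open import Data.Product using (_×_; _,_; ∃; Σ-syntax; proj₁; proj₂)
open import Data.Unit using (tt)
open import Data.Vec using (_∷_; lookup; _[_]%=_)
open import Data.Vec.Properties
  using ([]=⇒lookup; lookup⇒[]=; lookup∘tabulate; lookup∘updateAt; lookup∘updateAt′; lookup-replicate)
open import Function.Bundles using (_↔_; _⇔_; Inverse; Injection; Equivalence; mk⇔)
open import Function.Properties.Inverse using (Inverse⇒Injection)
open import Function.Base using (_∘_)
open import Relation.Nullary using (¬_; Dec; yes; no; does)
open import Relation.Binary.PropositionalEquality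

private variable k : ℕ

T-not⇒¬T : ∀ {c} → T (not c) → ¬ T c
T-not⇒¬T {false} _ ()

T-does : ∀ {P : Set} (d : Dec P) → T (does d) ⇔ P
T-does (yes p) = mk⇔ (λ _ → p) (λ _ → tt)
T-does (no ¬p) = mk⇔ (λ ()) ¬p

even : ℕ → Bool
even k = k % 2 ≡ᵇ 0

even-suc : ∀ k → even (suc k) ≡ not (even k)
even-suc zero          = refl
even-suc (suc zero)    = refl
even-suc (suc (suc k)) = even-suc k

toggle : Fin k → Subset k → Subset k
toggle i p = p [ i ]%= not

lookup-⊥ : (i : Fin k) → lookup ⊥ i ≡ false
lookup-⊥ i = lookup-replicate i false

∣toggle∣-∈ : ∀ (i : Fin k) p → lookup p i ≡ true → ∣ p ∣ ≡ suc ∣ toggle i p ∣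
∣toggle∣-∈ zero    (true  ∷ p) _ = refl
∣toggle∣-∈ (suc i) (true  ∷ p) e = cong suc (∣toggle∣-∈ i p e)
∣toggle∣-∈ (suc i) (false ∷ p) e = ∣toggle∣-∈ i p e

∣toggle∣-∉ : ∀ (i : Fin k) p → lookup p i ≡ false → ∣ toggle i p ∣ ≡ suc ∣ p ∣
∣toggle∣-∉ zero    (false ∷ p) _ = refl
∣toggle∣-∉ (suc i) (true  ∷ p) e = cong suc (∣toggle∣-∉ i p e)
∣toggle∣-∉ (suc i) (false ∷ p) e = ∣toggle∣-∉ i p e

even-toggle : ∀ (i : Fin k) p → even ∣ toggle i p ∣ ≡ not (even ∣ p ∣)
even-toggle i p with lookup p i in e
... | true  rewrite ∣toggle∣-∈ i p e =
  trans (sym (not-involutive _)) (cong not (sym (even-suc ∣ toggle i p ∣)))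
... | false rewrite ∣toggle∣-∉ i p e = even-suc ∣ p ∣

toggle-⊆ : ∀ {i : Fin k} {p q} → p ⊆ q → i ∈ q → toggle i p ⊆ q
toggle-⊆ {i = i} {p = p} p⊆q i∈q {j} j∈ with j ≟ᶠ i
... | yes refl = i∈q
... | no j≢i   = p⊆q (lookup⇒[]= j p (trans (sym (lookup∘updateAt′ j i j≢i p)) ([]=⇒lookup j∈)))

lookup-toggle₂-left : ∀ {i j : Fin k} p → i ≢ j → lookup (toggle i (toggle j p)) i ≡ not (lookup p i)
lookup-toggle₂-left {i = i} {j = j} p i≢j =
  trans (lookup∘updateAt i (toggle j p)) (cong not (lookup∘updateAt′ i j i≢j p))

lookup-toggle₂-right : ∀ {i j : Fin k} p → j ≢ i → lookup (toggle i (toggle j p)) j ≡ not (lookup p j)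
lookup-toggle₂-right {i = i} {j = j} p j≢i =
  trans (lookup∘updateAt′ j i j≢i (toggle j p)) (lookup∘updateAt j p)

lookup-toggle₂-other : ∀ {i j l : Fin k} p → l ≢ i → l ≢ j
                     → lookup (toggle i (toggle j p)) l ≡ lookup p l
lookup-toggle₂-other {i = i} {j = j} {l = l} p l≢i l≢j =
  trans (lookup∘updateAt′ l i l≢i (toggle j p)) (lookup∘updateAt′ l j l≢j p)

toggle-member : ∀ {i j : Fin k} p → lookup p i ≡ true → lookup (toggle i p) j ≡ true
              → j ≢ i × lookup p j ≡ true
toggle-member {i = i} {j = j} p pi pj with j ≟ᶠ i
... | yes refl = ⊥-elim (not-¬ (sym pi) (sym (trans (sym (lookup∘updateAt i p)) pj)))
... | no j≢i   = j≢i , trans (sym (lookup∘updateAt′ j i j≢i p)) pj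

member : ∀ (p : Subset k) → 1 ≤ ∣ p ∣ → ∃ λ i → lookup p i ≡ true
member (true  ∷ p) _ = zero , refl
member (false ∷ p) 1≤ with member p 1≤
... | i , pi = suc i , pi

two-members : ∀ (p : Subset k) → 2 ≤ ∣ p ∣
            → Σ[ i ∈ Fin k ] Σ[ j ∈ Fin k ] lookup p i ≡ true × lookup p j ≡ true × i ≢ j
two-members p 2≤ with member p (≤-trans (s≤s z≤n) 2≤)
... | i , pi with member (toggle i p) (s≤s⁻¹ (subst (2 ≤_) (∣toggle∣-∈ i p pi) 2≤))
... | j , pj′ with toggle-member p pi pj′
... | j≢i , pj = i , j , pi , pj , (λ i≡j → j≢i (sym i≡j))

two-members-besides : ∀ (p : Subset k) → 3 ≤ ∣ p ∣ → ∀ v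
  → Σ[ i ∈ Fin k ] Σ[ j ∈ Fin k ] lookup p i ≡ true × lookup p j ≡ true × i ≢ v × j ≢ v × i ≢ j
two-members-besides p 3≤ v with lookup p v in pv
... | true with two-members (toggle v p) (s≤s⁻¹ (subst (3 ≤_) (∣toggle∣-∈ v p pv) 3≤))
...   | i , j , pi′ , pj′ , i≢j with toggle-member p pv pi′ | toggle-member p pv pj′
...     | i≢v , pi | j≢v , pj = i , j , pi , pj , i≢v , j≢v , i≢j
two-members-besides p 3≤ v | false with two-members p (≤-trans (n≤1+n 2) 3≤)
...   | i , j , pi , pj , i≢j = i , j , pi , pj , ≢v pi , ≢v pj , i≢j
  where
    ≢v : ∀ {i} → lookup p i ≡ true → i ≢ v
    ≢v pi refl = not-¬ pi pv

pair : Fin k → Fin k → Subset k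
pair i j = toggle i (toggle j ⊥)

lookup-pair-left : ∀ {i j : Fin k} → i ≢ j → lookup (pair i j) i ≡ true
lookup-pair-left {i = i} i≢j = trans (lookup-toggle₂-left ⊥ i≢j) (cong not (lookup-⊥ i))

lookup-pair-right : ∀ {i j : Fin k} → j ≢ i → lookup (pair i j) j ≡ true
lookup-pair-right {j = j} j≢i = trans (lookup-toggle₂-right ⊥ j≢i) (cong not (lookup-⊥ j))

lookup-pair-other : ∀ {i j l : Fin k} → l ≢ i → l ≢ j → lookup (pair i j) l ≡ false
lookup-pair-other {l = l} l≢i l≢j = trans (lookup-toggle₂-other ⊥ l≢i l≢j) (lookup-⊥ l)

module Gadgets {n : ℕ} (G : Graph n) where

  V : Set
  V = YV G

  adj-sym : ∀ {u v} → Adj G u v → Adj G v u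
  adj-sym {u} {v} = subst T (Graph.sym G u v)

  lookup-nbhd : ∀ {u v} → lookup (nbhd G u) v ≡ true → Adj G u v
  lookup-nbhd {u} {v} e = Equivalence.from T-≡ (trans (sym (lookup∘tabulate (Graph.adj G u) v)) e)

  adj⇒∈nbhd : ∀ {u v} → Adj G u v → v ∈ nbhd G u
  adj⇒∈nbhd {u} {v} p =
    lookup⇒[]= v (nbhd G u) (trans (lookup∘tabulate (Graph.adj G u) v) (Equivalence.to T-≡ p))

  valid⇒⊆ : ∀ {u m} → T (validMid G u m) → m ⊆ nbhd G u
  valid⇒⊆ {u} {m} q = Equivalence.to (T-does (m ⊆? nbhd G u)) (proj₁ (Equivalence.to T-∧ q))

  valid⇒even : ∀ {u m} → T (validMid G u m) → even ∣ m ∣ ≡ true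
  valid⇒even {u} {m} q = Equivalence.to T-≡ (proj₂ (Equivalence.to (T-∧ {does (m ⊆? nbhd G u)}) q))

  valid-intro : ∀ {u m} → m ⊆ nbhd G u → even ∣ m ∣ ≡ true → T (validMid G u m)
  valid-intro {u} {m} m⊆ ev =
    Equivalence.from T-∧ (Equivalence.from (T-does (m ⊆? nbhd G u)) m⊆ , Equivalence.from T-≡ ev)

  valid-∅ : ∀ {u} → T (validMid G u ⊥)
  valid-∅ {u} = valid-intro {u} {⊥} ⊥⊆ (cong even (∣⊥∣≡0 n))

  valid-toggle₂ : ∀ {u} m {i j} → T (validMid G u m) → Adj G u i → Adj G u j
                → T (validMid G u (toggle i (toggle j m)))
  valid-toggle₂ {u} m {i} {j} q u~i u~j =
    valid-intro {u} {toggle i (toggle j m)}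
      (toggle-⊆ (toggle-⊆ (valid⇒⊆ {u} {m} q) (adj⇒∈nbhd u~j)) (adj⇒∈nbhd u~i)) parity
    where
      open ≡-Reasoning
      parity : even ∣ toggle i (toggle j m) ∣ ≡ true
      parity = begin
        even ∣ toggle i (toggle j m) ∣   ≡⟨ even-toggle i (toggle j m) ⟩
        not (even ∣ toggle j m ∣)        ≡⟨ cong not (even-toggle j m) ⟩
        not (not (even ∣ m ∣))           ≡⟨ not-involutive _ ⟩
        even ∣ m ∣                       ≡⟨ valid⇒even {u} {m} q ⟩
        true                             ∎

  valid-pair : ∀ {u i j} → Adj G u i → Adj G u j → T (validMid G u (pair i j))
  valid-pair {u} = valid-toggle₂ ⊥ (valid-∅ {u})

  isMid : V → Bool
  isMid (mid _ _ _) = true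
  isMid _           = false

  gadget : V → Fin n
  gadget (a u _ _)   = u
  gadget (b u _ _)   = u
  gadget (mid u _ _) = u

  -- junk value on middle vertices
  port : V → Fin n
  port (a _ v _)   = v
  port (b _ v _)   = v
  port (mid u _ _) = u

  MidIn PortIn : Fin n → V → Set
  MidIn  u x = isMid x ≡ true  × gadget x ≡ u
  PortIn u x = isMid x ≡ false × gadget x ≡ u

  port-adj : ∀ x → isMid x ≡ false → Adj G (gadget x) (port x)
  port-adj (a _ _ p) _ = p
  port-adj (b _ _ p) _ = p

  a-or-b : ∀ u k → Adj G u k → Bool → V
  a-or-b u k p true  = a u k p
  a-or-b u k p false = b u k p

  port-a-or-b : ∀ {u k} (p : Adj G u k) c → port (a-or-b u k p c) ≡ k
  port-a-or-b p true  = refl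
  port-a-or-b p false = refl

  isTw-sym : ∀ t u v → isTw G t u v ≡ isTw G t v u
  isTw-sym nothing          u v = refl
  isTw-sym (just (u₀ , v₀)) u v =
    trans (∨-comm (does (u ≟ᶠ u₀) ∧ does (v ≟ᶠ v₀)) _)
          (cong₂ _∨_ (∧-comm (does (u ≟ᶠ v₀)) _) (∧-comm (does (u ≟ᶠ u₀)) _))

  b≢a : ∀ {u v u′ v′ p p′} → b {G = G} u v p ≢ a u′ v′ p′
  b≢a ()

  mid-injective : ∀ {u M M′ q q′} → mid {G = G} u M q ≡ mid u M′ q′ → M ≡ M′
  mid-injective refl = refl

  sameColour-ports : ∀ {s x y} → PortIn s x → PortIn s y → port x ≡ port y → SameColor G x y
  sameColour-ports {x = a _ _ _} {a _ _ _} (_ , refl) (_ , refl) e = refl , e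
  sameColour-ports {x = a _ _ _} {b _ _ _} (_ , refl) (_ , refl) e = refl , e
  sameColour-ports {x = b _ _ _} {a _ _ _} (_ , refl) (_ , refl) e = refl , e
  sameColour-ports {x = b _ _ _} {b _ _ _} (_ , refl) (_ , refl) e = refl , e

  sameColour-mids : ∀ {s x y} → MidIn s x → MidIn s y → SameColor G x y
  sameColour-mids {x = mid _ _ _} {mid _ _ _} (_ , refl) (_ , refl) = refl

module Edges {n : ℕ} (G : Graph n) (t : Maybe (Fin n × Fin n)) where
  open Gadgets G

  E : V → V → Set
  E = YEdge G t

  edge-sym : ∀ {x y} → E x y → E y x
  edge-sym (a-m k∈) = m-a k∈
  edge-sym (m-a k∈) = a-m k∈
  edge-sym (b-m k∉) = m-b k∉
  edge-sym (m-b k∉) = b-m k∉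
  edge-sym {a u v _} (a-a ¬tw) = a-a (subst (λ c → T (not c)) (isTw-sym t u v) ¬tw)
  edge-sym {b u v _} (b-b ¬tw) = b-b (subst (λ c → T (not c)) (isTw-sym t u v) ¬tw)
  edge-sym {a u v _} (a-b tw)  = b-a (subst T (isTw-sym t u v) tw)
  edge-sym {b u v _} (b-a tw)  = a-b (subst T (isTw-sym t u v) tw)

  mid-neighbour : ∀ {x y} → E x y → isMid x ≡ true → PortIn (gadget x) y
  mid-neighbour {a _ _ _} _ ()
  mid-neighbour {b _ _ _} _ ()
  mid-neighbour (m-a _) _ = refl , refl
  mid-neighbour (m-b _) _ = refl , refl

  port-edge : ∀ {x y} → E x y → isMid x ≡ false → isMid y ≡ false
            → gadget y ≡ port x × port y ≡ gadget x
  port-edge {y = mid _ _ _} _ _ ()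
  port-edge {x = mid _ _ _} _ () _
  port-edge (a-a _) _ _ = refl , refl
  port-edge (b-b _) _ _ = refl , refl
  port-edge (a-b _) _ _ = refl , refl
  port-edge (b-a _) _ _ = refl , refl

  port-neighbour : ∀ x → isMid x ≡ false → Σ[ y ∈ V ] E x y × isMid y ≡ false
  port-neighbour (a u v p) _ with isTw G t u v in tw
  ... | true  = b v u (adj-sym p) , a-b (Equivalence.from T-≡ tw) , refl
  ... | false = a v u (adj-sym p) , a-a (Equivalence.from T-not-≡ tw) , refl
  port-neighbour (b u v p) _ with isTw G t u v in tw
  ... | true  = a v u (adj-sym p) , b-a (Equivalence.from T-≡ tw) , refl
  ... | false = b v u (adj-sym p) , b-b (Equivalence.from T-not-≡ tw) , refl

  port-neighbour-unique : ∀ {x y y′} → E x y → E x y′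
    → isMid x ≡ false → isMid y ≡ false → isMid y′ ≡ false → y ≡ y′
  port-neighbour-unique {x = mid _ _ _} _ _ () _ _
  port-neighbour-unique {y = mid _ _ _} _ _ _ () _
  port-neighbour-unique {y′ = mid _ _ _} _ _ _ _ ()
  port-neighbour-unique (a-a _)   (a-a _)  _ _ _ = cong (a _ _) (T-irrelevant _ _)
  port-neighbour-unique (a-b _)   (a-b _)  _ _ _ = cong (b _ _) (T-irrelevant _ _)
  port-neighbour-unique (b-b _)   (b-b _)  _ _ _ = cong (b _ _) (T-irrelevant _ _)
  port-neighbour-unique (b-a _)   (b-a _)  _ _ _ = cong (a _ _) (T-irrelevant _ _)
  port-neighbour-unique (a-a ¬tw) (a-b tw) _ _ _ = ⊥-elim (T-not⇒¬T ¬tw tw)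
  port-neighbour-unique (a-b tw) (a-a ¬tw) _ _ _ = ⊥-elim (T-not⇒¬T ¬tw tw)
  port-neighbour-unique (b-b ¬tw) (b-a tw) _ _ _ = ⊥-elim (T-not⇒¬T ¬tw tw)
  port-neighbour-unique (b-a tw) (b-b ¬tw) _ _ _ = ⊥-elim (T-not⇒¬T ¬tw tw)

  mid-neighbour-unique : ∀ {x y y′} → E x y → E x y′ → isMid x ≡ true → port y ≡ port y′ → y ≡ y′
  mid-neighbour-unique {a _ _ _} _ _ () _
  mid-neighbour-unique {b _ _ _} _ _ () _
  mid-neighbour-unique (m-a _)  (m-a _)  _ refl = cong (a _ _) (T-irrelevant _ _)
  mid-neighbour-unique (m-b _)  (m-b _)  _ refl = cong (b _ _) (T-irrelevant _ _)
  mid-neighbour-unique (m-a k∈) (m-b k∉) _ refl = ⊥-elim (k∉ k∈)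
  mid-neighbour-unique (m-b k∉) (m-a k∈) _ refl = ⊥-elim (k∉ k∈)

  twins-no-common-neighbour : ∀ {u v p p′ y} → E (a u v p) y → ¬ E (b u v p′) y
  twins-no-common-neighbour (a-m k∈)  (b-m k∉)  = k∉ k∈
  twins-no-common-neighbour (a-a ¬tw) (b-a tw)  = T-not⇒¬T ¬tw tw
  twins-no-common-neighbour (a-b tw)  (b-b ¬tw) = T-not⇒¬T ¬tw tw

  mid-edge-a : ∀ {u M q k p} → lookup M k ≡ true → E (mid u M q) (a u k p)
  mid-edge-a e = m-a (lookup⇒[]= _ _ e)

  mid-edge-b : ∀ {u M q k p} → lookup M k ≡ false → E (mid u M q) (b u k p)
  mid-edge-b e = m-b (λ k∈ → not-¬ ([]=⇒lookup k∈) e)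

  mid-edge-a-or-b : ∀ {u M q k} (p : Adj G u k) → E (mid u M q) (a-or-b u k p (lookup M k))
  mid-edge-a-or-b {M = M} {k = k} p with lookup M k in e
  ... | true  = mid-edge-a e
  ... | false = mid-edge-b e

  mid-edge-agree : ∀ {u M M′ q′ k} (p : Adj G u k) → lookup M′ k ≡ lookup M k
                 → E (mid u M′ q′) (a-or-b u k p (lookup M k))
  mid-edge-agree p e = subst (λ c → E _ (a-or-b _ _ p c)) e (mid-edge-a-or-b p)

  mid-edge-transfer : ∀ {u M q M′ q′ x} → E (mid u M q) x → lookup M′ (port x) ≡ lookup M (port x)
                    → E (mid u M′ q′) x
  mid-edge-transfer (m-a k∈) e = mid-edge-a (trans e ([]=⇒lookup k∈))
  mid-edge-transfer (m-b k∉) e = mid-edge-b (trans e (¬-not (λ e′ → k∉ (lookup⇒[]= _ _ e′))))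

  common-mid-neighbour : ∀ x y {r} → isMid x ≡ false → isMid y ≡ false → gadget x ≡ gadget y
    → port x ≢ port y → Adj G (gadget x) r → r ≢ port x → r ≢ port y → Σ[ m ∈ V ] E m x × E m y
  common-mid-neighbour (a s i p) (a _ j p′) _ _ refl i≢j _ _ _ =
    mid s (pair i j) (valid-pair p p′) ,
    mid-edge-a (lookup-pair-left i≢j) , mid-edge-a (lookup-pair-right (≢-sym i≢j))
  common-mid-neighbour (a s i p) (b _ j _) {r} _ _ refl i≢j s~r r≢i r≢j =
    mid s (pair i r) (valid-pair p s~r) ,
    mid-edge-a (lookup-pair-left (≢-sym r≢i)) , mid-edge-b (lookup-pair-other (≢-sym i≢j) (≢-sym r≢j))
  common-mid-neighbour (b s i _) (a _ j p′) {r} _ _ refl i≢j s~r r≢i r≢j =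
    mid s (pair j r) (valid-pair p′ s~r) ,
    mid-edge-b (lookup-pair-other i≢j (≢-sym r≢i)) , mid-edge-a (lookup-pair-left (≢-sym r≢j))
  common-mid-neighbour (b s i _) (b _ j _) _ _ refl _ _ _ _ =
    mid s ⊥ valid-∅ , mid-edge-b (lookup-⊥ i) , mid-edge-b (lookup-⊥ j)

  record Hexagon (x₀ x₁ : V) : Set where
    field
      x₂ x₃ x₄ x₅ : V
      e₀₁ : E x₀ x₁
      e₁₂ : E x₁ x₂
      e₂₃ : E x₂ x₃
      e₃₄ : E x₃ x₄
      e₄₅ : E x₄ x₅
      e₅₀ : E x₅ x₀
      x₂≢x₀ : x₂ ≢ x₀
      x₃≢x₁ : x₃ ≢ x₁
      x₅≢x₃ : x₅ ≢ x₃
      x₁≢x₅ : x₁ ≢ x₅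

  port-edge-not-on-hexagon : ∀ {x₀ x₁} → isMid x₀ ≡ false → isMid x₁ ≡ false → ¬ Hexagon x₀ x₁
  port-edge-not-on-hexagon {x₀} {x₁} m₀ m₁ H = impossible
    where
      open Hexagon H
      -- x₂ and x₅ are forced to be middle vertices and x₄ a port vertex; then x₁ and x₃ are
      -- neighbours of x₂ with the same port.
      impossible : Empty
      impossible with isMid x₂ in m₂
      ... | false = x₂≢x₀ (port-neighbour-unique e₁₂ (edge-sym e₀₁) m₁ m₂ m₀)
      ... | true with proj₁ (mid-neighbour e₂₃ m₂) | isMid x₄ in m₄
      ...   | _  | true  =
        x₁≢x₅ (port-neighbour-unique e₀₁ (edge-sym e₅₀) m₀ m₁ (proj₁ (mid-neighbour e₄₅ m₄)))
      ...   | m₃ | false with isMid x₅ in m₅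
      ...     | false = x₅≢x₃ (port-neighbour-unique e₄₅ (edge-sym e₃₄) m₄ m₅ m₃)
      ...     | true  = x₃≢x₁ (mid-neighbour-unique e₂₃ (edge-sym e₁₂) m₂ (begin
        port x₃    ≡⟨ sym (proj₁ (port-edge e₃₄ m₃ m₄)) ⟩
        gadget x₄  ≡⟨ proj₂ (mid-neighbour (edge-sym e₄₅) m₅) ⟩
        gadget x₅  ≡⟨ sym (proj₂ (mid-neighbour e₅₀ m₅)) ⟩
        gadget x₀  ≡⟨ sym (proj₂ (port-edge e₀₁ m₀ m₁)) ⟩
        port x₁    ∎))
        where open ≡-Reasoning

  mid-edge-on-hexagon : ∀ {u M q x} → E (mid u M q) x → ∀ {w z} → Adj G u w → Adj G u z
    → w ≢ port x → z ≢ port x → w ≢ z → Hexagon (mid u M q) x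
  mid-edge-on-hexagon {u} {M} {q} {x} e {w} {z} u~w u~z w≢v z≢v w≢z = record
    { x₂ = mid u M₁ (valid-toggle₂ M q u~w u~z)
    ; x₃ = x₃
    ; x₄ = mid u M₂ (valid-toggle₂ M q u~v u~w)
    ; x₅ = x₅
    ; e₀₁ = e
    ; e₁₂ = edge-sym (mid-edge-transfer e (lookup-toggle₂-other M (≢-sym w≢v) (≢-sym z≢v)))
    ; e₂₃ = mid-edge-a-or-b u~w
    ; e₃₄ = edge-sym (mid-edge-agree {M = M₁} u~w (trans M₂-w (sym M₁-w)))
    ; e₄₅ = mid-edge-a-or-b u~z
    ; e₅₀ = edge-sym (mid-edge-agree {M = M₂} u~z (sym (lookup-toggle₂-other M z≢v (≢-sym w≢z))))
    ; x₂≢x₀ = λ eq → not-¬ refl (trans (cong (λ S → lookup S w) (sym (mid-injective eq))) M₁-w)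
    ; x₃≢x₁ = λ eq → w≢v (trans (sym port₃) (cong port eq))
    ; x₅≢x₃ = λ eq → w≢z (trans (sym port₃) (trans (sym (cong port eq)) port₅))
    ; x₁≢x₅ = λ eq → z≢v (trans (sym port₅) (sym (cong port eq)))
    }
    where
      v = port x
      u~v : Adj G u v
      u~v with mid-neighbour e refl
      ... | x-port , refl = port-adj x x-port
      -- x₂ keeps the neighbour x at port v, x₂ and x₄ share the neighbour at port w, and x₄
      -- and x₀ share the neighbour at port z.
      M₁ M₂ : Subset n
      M₁ = toggle w (toggle z M)
      M₂ = toggle v (toggle w M)
      M₁-w : lookup M₁ w ≡ not (lookup M w)
      M₁-w = lookup-toggle₂-left M w≢z
      M₂-w : lookup M₂ w ≡ not (lookup M w)
      M₂-w = lookup-toggle₂-right M w≢v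
      x₃ x₅ : V
      x₃ = a-or-b u w u~w (lookup M₁ w)
      x₅ = a-or-b u z u~z (lookup M₂ z)
      port₃ : port x₃ ≡ w
      port₃ = port-a-or-b u~w (lookup M₁ w)
      port₅ : port x₅ ≡ z
      port₅ = port-a-or-b u~z (lookup M₂ z)

module Automorphism {n : ℕ} (G : Graph n) (t : Maybe (Fin n × Fin n)) (g : YV G ↔ YV G)
  (hom : ∀ x y → YEdge G t x y ⇔ YEdge G t (Inverse.to g x) (Inverse.to g y)) where
  open Gadgets G
  open Edges G t

  f h : V → V
  f = Inverse.to g
  h = Inverse.from g

  f∘h : ∀ y → f (h y) ≡ y
  f∘h = Inverse.strictlyInverseˡ g

  f-injective : ∀ {x y} → f x ≡ f y → x ≡ y
  f-injective = Injection.injective (Inverse⇒Injection g)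

  f-edge : ∀ {x y} → E x y → E (f x) (f y)
  f-edge = Equivalence.to (hom _ _)

  pull-edge : ∀ {x y} → E (f x) y → E x (h y)
  pull-edge {x} {y} e = Equivalence.from (hom x (h y)) (subst (E (f x)) (sym (f∘h y)) e)

  f-hexagon : ∀ {x₀ x₁} → Hexagon x₀ x₁ → Hexagon (f x₀) (f x₁)
  f-hexagon H = record
    { x₂ = f x₂ ; x₃ = f x₃ ; x₄ = f x₄ ; x₅ = f x₅
    ; e₀₁ = f-edge e₀₁ ; e₁₂ = f-edge e₁₂ ; e₂₃ = f-edge e₂₃
    ; e₃₄ = f-edge e₃₄ ; e₄₅ = f-edge e₄₅ ; e₅₀ = f-edge e₅₀
    ; x₂≢x₀ = x₂≢x₀ ∘ f-injective ; x₃≢x₁ = x₃≢x₁ ∘ f-injective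
    ; x₅≢x₃ = x₅≢x₃ ∘ f-injective ; x₁≢x₅ = x₁≢x₅ ∘ f-injective
    }
    where open Hexagon H

  mid-image-of-degree-3 : ∀ {u} → 3 ≤ deg G u → ∀ M q → isMid (f (mid u M q)) ≡ true
  mid-image-of-degree-3 {u} 3≤ M q with isMid (f (mid u M q)) in fm
  ... | true = refl
  ... | false with port-neighbour (f (mid u M q)) fm
  ...   | y , e , my with two-members-besides (nbhd G u) 3≤ (port (h y))
  ...     | w , z , w∈ , z∈ , w≢ , z≢ , w≢z =
    ⊥-elim (port-edge-not-on-hexagon fm (trans (cong isMid (f∘h y)) my)
      (f-hexagon (mid-edge-on-hexagon (pull-edge e) (lookup-nbhd w∈) (lookup-nbhd z∈) w≢ z≢ w≢z)))

  image-port-injective : ∀ {m x y} → E m x → E m y → isMid (f m) ≡ true → port (f x) ≡ port (f y) → x ≡ y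
  image-port-injective ex ey fm eq = f-injective (mid-neighbour-unique (f-edge ex) (f-edge ey) fm eq)

  mid-image-gadget : ∀ {m x s} → E m x → isMid (f m) ≡ true → PortIn s (f x) → MidIn s (f m)
  mid-image-gadget e fm (_ , fx∈s) = fm , trans (sym (proj₂ (mid-neighbour (f-edge e) fm))) fx∈s

  co-neighbour-image : ∀ {m x y s} → E m x → E m y → isMid (f m) ≡ true → PortIn s (f x) → PortIn s (f y)
  co-neighbour-image ex ey fm fx =
    proj₁ (mid-neighbour (f-edge ey) fm) ,
    trans (proj₂ (mid-neighbour (f-edge ey) fm)) (proj₂ (mid-image-gadget ex fm fx))

  twin-images-share-port : ∀ {w i s} (p : Adj G w i) z
    → PortIn s (f (a w i p)) → PortIn s (f (b w i p)) → PortIn s (f z)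
    → port (f z) ≢ port (f (a w i p)) → port (f z) ≢ port (f (b w i p))
    → port (f (a w i p)) ≡ port (f (b w i p))
  twin-images-share-port {w} {i} p z (ma , ga) (mb , gb) (mz , gz) z≢a z≢b
    with port (f (a w i p)) ≟ᶠ port (f (b w i p))
  ... | yes same = same
  ... | no differ
    with common-mid-neighbour (f (a w i p)) (f (b w i p)) ma mb (trans ga (sym gb)) differ
           (subst (λ c → Adj G c (port (f z))) (trans gz (sym ga)) (port-adj (f z) mz)) z≢a z≢b
  ...   | _ , ea , eb =
    ⊥-elim (twins-no-common-neighbour (pull-edge (edge-sym ea)) (pull-edge (edge-sym eb)))

  record GadgetMapped (u : Fin n) : Set where
    field
      image : Fin n
      mids  : ∀ M q → MidIn image (f (mid u M q))
      as    : ∀ v p → PortIn image (f (a u v p))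
      bs    : ∀ v p → PortIn image (f (b u v p))
      twins : ∀ v p → port (f (a u v p)) ≡ port (f (b u v p))

  module _ {u} (gm : GadgetMapped u) where
    open GadgetMapped gm

    mid↦ : ∀ {x} → MidIn u x → MidIn image (f x)
    mid↦ {mid _ M q} (_ , refl) = mids M q

    port↦ : ∀ {x} → PortIn u x → PortIn image (f x)
    port↦ {a _ v p} (_ , refl) = as v p
    port↦ {b _ v p} (_ , refl) = bs v p

    twin↦ : ∀ {x y} → PortIn u x → PortIn u y → port x ≡ port y → port (f x) ≡ port (f y)
    twin↦ {a _ v p} {a _ _ p′} (_ , refl) (_ , refl) refl rewrite T-irrelevant p p′ = refl
    twin↦ {a _ v p} {b _ _ p′} (_ , refl) (_ , refl) refl rewrite T-irrelevant p p′ = twins v p′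
    twin↦ {b _ v p} {a _ _ p′} (_ , refl) (_ , refl) refl rewrite T-irrelevant p p′ = sym (twins v p′)
    twin↦ {b _ v p} {b _ _ p′} (_ , refl) (_ , refl) refl rewrite T-irrelevant p p′ = refl

  gadgetMapped-from : ∀ {w v s} (w~v : Adj G w v) → (∀ M q → isMid (f (mid w M q)) ≡ true)
    → PortIn s (f (a w v w~v)) → PortIn s (f (b w v w~v))
    → port (f (a w v w~v)) ≡ port (f (b w v w~v)) → GadgetMapped w
  gadgetMapped-from {w} {v} {s} w~v mid↦mid fa fb fa≡fb =
    record { image = s ; mids = mids ; as = as ; bs = bs ; twins = twins }
    where
      f∅ : isMid (f (mid w ⊥ valid-∅)) ≡ true
      f∅ = mid↦mid ⊥ valid-∅

      mids : ∀ M q → MidIn s (f (mid w M q))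
      mids M q with lookup M v in v∈?
      ... | true  = mid-image-gadget (mid-edge-a v∈?) (mid↦mid M q) fa
      ... | false = mid-image-gadget (mid-edge-b v∈?) (mid↦mid M q) fb

      bs : ∀ w′ p′ → PortIn s (f (b w w′ p′))
      bs w′ _ = co-neighbour-image (mid-edge-b (lookup-⊥ v)) (mid-edge-b (lookup-⊥ w′)) f∅ fb

      as : ∀ w′ p′ → PortIn s (f (a w w′ p′))
      as w′ p′ with w′ ≟ᶠ v
      ... | yes refl rewrite T-irrelevant p′ w~v = fa
      ... | no w′≢v = co-neighbour-image (mid-edge-a (lookup-pair-right (≢-sym w′≢v)))
                        (mid-edge-a (lookup-pair-left w′≢v)) (mid↦mid (pair w′ v) (valid-pair p′ w~v)) fa

      twins : ∀ w′ p′ → port (f (a w w′ p′)) ≡ port (f (b w w′ p′))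
      twins w′ p′ with w′ ≟ᶠ v
      ... | yes refl rewrite T-irrelevant p′ w~v = fa≡fb
      ... | no w′≢v = twin-images-share-port p′ (a w v w~v) (as w′ p′) (bs w′ p′) fa a≢ b≢
        where
          a≢ : port (f (a w v w~v)) ≢ port (f (a w w′ p′))
          a≢ eq = w′≢v (cong port (image-port-injective
            (mid-edge-a (lookup-pair-left w′≢v)) (mid-edge-a (lookup-pair-right (≢-sym w′≢v)))
            (mid↦mid (pair w′ v) (valid-pair p′ w~v)) (sym eq)))
          b≢ : port (f (a w v w~v)) ≢ port (f (b w w′ p′))
          b≢ eq = w′≢v (cong port (image-port-injective
            (mid-edge-b (lookup-⊥ w′)) (mid-edge-b (lookup-⊥ v)) f∅ (trans (sym eq) fa≡fb)))

  port-neighbour-image-port : ∀ {v X x} → GadgetMapped v → E X x → PortIn v X → isMid x ≡ false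
                            → isMid (f x) ≡ false
  port-neighbour-image-port gm e X∈v mx with port-neighbour (f _) (proj₁ (port↦ gm X∈v))
  ... | y , ey , my with isMid (h y) in mhy
  ... | true  = ⊥-elim (not-¬ (trans (sym (cong isMid (f∘h y))) (proj₁ (mid↦ gm (mhy , hy∈v)))) my)
    where
      hy∈v = trans (sym (proj₂ (mid-neighbour (edge-sym (pull-edge ey)) mhy))) (proj₂ X∈v)
  ... | false = trans (cong (isMid ∘ f) (sym (port-neighbour-unique (pull-edge ey) e (proj₁ X∈v) mhy mx)))
                      (trans (cong isMid (f∘h y)) my)

  mid-neighbour-image-mid : ∀ {x X m} → E x X → isMid x ≡ false → isMid X ≡ false
    → isMid (f x) ≡ false → isMid (f X) ≡ false → E x m → isMid m ≡ true → isMid (f m) ≡ true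
  mid-neighbour-image-mid {m = m} eX mx mX mfx mfX em mm with isMid (f m) in mfm
  ... | true  = refl
  ... | false = ⊥-elim (not-¬ mm (trans (cong isMid m≡X) mX))
    where m≡X = f-injective (port-neighbour-unique (f-edge em) (f-edge eX) mfx mfm mfX)

  gadgetMapped-step : ∀ {v w} → GadgetMapped v → Adj G v w → GadgetMapped w
  gadgetMapped-step {v} {w} gm v~w
    with port-neighbour (a w v (adj-sym v~w)) refl | port-neighbour (b w v (adj-sym v~w)) refl
  ... | Xa , ea , mXa | Xb , eb , mXb =
    gadgetMapped-from w~v mid↦mid (mfa , refl) (mfb , gadget-fb) port-fa≡port-fb
    where
      open ≡-Reasoning
      w~v = adj-sym v~w
      Xa∈v : PortIn v Xa
      Xa∈v = mXa , proj₁ (port-edge ea refl mXa)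
      Xb∈v : PortIn v Xb
      Xb∈v = mXb , proj₁ (port-edge eb refl mXb)
      mfa = port-neighbour-image-port gm (edge-sym ea) Xa∈v refl
      mfb = port-neighbour-image-port gm (edge-sym eb) Xb∈v refl
      fXa = port↦ gm Xa∈v
      fXb = port↦ gm Xb∈v
      across-a = port-edge (f-edge (edge-sym ea)) (proj₁ fXa) mfa
      across-b = port-edge (f-edge (edge-sym eb)) (proj₁ fXb) mfb

      gadget-fb : gadget (f (b w v w~v)) ≡ gadget (f (a w v w~v))
      gadget-fb = begin
        gadget (f (b w v w~v))  ≡⟨ proj₁ across-b ⟩
        port (f Xb)             ≡⟨ twin↦ gm Xb∈v Xa∈v (trans (proj₂ (port-edge eb refl mXb))
                                                             (sym (proj₂ (port-edge ea refl mXa)))) ⟩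
        port (f Xa)             ≡⟨ sym (proj₁ across-a) ⟩
        gadget (f (a w v w~v))  ∎

      port-fa≡port-fb : port (f (a w v w~v)) ≡ port (f (b w v w~v))
      port-fa≡port-fb = begin
        port (f (a w v w~v))  ≡⟨ proj₂ across-a ⟩
        gadget (f Xa)         ≡⟨ trans (proj₂ fXa) (sym (proj₂ fXb)) ⟩
        gadget (f Xb)         ≡⟨ sym (proj₂ across-b) ⟩
        port (f (b w v w~v))  ∎

      mid↦mid : ∀ M q → isMid (f (mid w M q)) ≡ true
      mid↦mid M q with lookup M v in v∈?
      ... | true  = mid-neighbour-image-mid ea refl mXa mfa (proj₁ fXa) (edge-sym (mid-edge-a v∈?)) refl
      ... | false = mid-neighbour-image-mid eb refl mXb mfb (proj₁ fXb) (edge-sym (mid-edge-b v∈?)) refl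

  gadgetMapped-of-degree-3 : ∀ {u} → 3 ≤ deg G u → GadgetMapped u
  gadgetMapped-of-degree-3 {u} 3≤ with member (nbhd G u) (≤-trans (s≤s z≤n) 3≤)
  ... | i , i∈ with two-members-besides (nbhd G u) 3≤ i
  ... | j , k , j∈ , k∈ , j≢i , k≢i , j≢k = gadgetMapped-from u~i mid↦mid fai fbi twins
    where
      u~i = lookup-nbhd i∈
      u~k = lookup-nbhd k∈
      mid↦mid = mid-image-of-degree-3 3≤
      Mij : V
      Mij = mid u (pair i j) (valid-pair u~i (lookup-nbhd j∈))
      fMij : isMid (f Mij) ≡ true
      fMij = mid↦mid (pair i j) _
      f∅ : isMid (f (mid u ⊥ valid-∅)) ≡ true
      f∅ = mid↦mid ⊥ valid-∅
      i∈ij : E Mij (a u i u~i)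
      i∈ij = mid-edge-a (lookup-pair-left (≢-sym j≢i))
      k∉ij : E Mij (b u k u~k)
      k∉ij = mid-edge-b (lookup-pair-other k≢i (≢-sym j≢k))
      fbk : PortIn (gadget (f (b u k u~k))) (f (b u k u~k))
      fbk = proj₁ (mid-neighbour (f-edge k∉ij) fMij) , refl
      fai = co-neighbour-image k∉ij i∈ij fMij fbk
      fbi = co-neighbour-image (mid-edge-b (lookup-⊥ k)) (mid-edge-b (lookup-⊥ i)) f∅ fbk
      twins = twin-images-share-port u~i (b u k u~k) fai fbi fbk
        (λ eq → b≢a (image-port-injective k∉ij i∈ij fMij eq))
        (λ eq → k≢i (cong port (image-port-injective
                                  (mid-edge-b (lookup-⊥ k)) (mid-edge-b (lookup-⊥ i)) f∅ eq)))

  every-gadget-mapped : Connected G → ∃ (λ u → 3 ≤ deg G u) → ∀ u → GadgetMapped u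
  every-gadget-mapped conn (u₀ , 3≤) u = reach (conn u₀ u)
    where
      reach : ∀ {u} → Reach G u₀ u → GadgetMapped u
      reach here         = gadgetMapped-of-degree-3 3≤
      reach (step r v~w) = gadgetMapped-step (reach r) v~w

  preserves-colour : Connected G → ∃ (λ u → 3 ≤ deg G u)
                   → ∀ x y → SameColor G x y → SameColor G (f x) (f y)
  preserves-colour conn hub = preserves
    where
      mapped = every-gadget-mapped conn hub

      ports : ∀ {u x y} → PortIn u x → PortIn u y → port x ≡ port y → SameColor G (f x) (f y)
      ports {u} x∈u y∈u eq =
        sameColour-ports (port↦ (mapped u) x∈u) (port↦ (mapped u) y∈u) (twin↦ (mapped u) x∈u y∈u eq)

      preserves : ∀ x y → SameColor G x y → SameColor G (f x) (f y)
      preserves (a _ _ _)   (a _ _ _)   (refl , refl) = ports (refl , refl) (refl , refl) refl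
      preserves (a _ _ _)   (b _ _ _)   (refl , refl) = ports (refl , refl) (refl , refl) refl
      preserves (b _ _ _)   (a _ _ _)   (refl , refl) = ports (refl , refl) (refl , refl) refl
      preserves (b _ _ _)   (b _ _ _)   (refl , refl) = ports (refl , refl) (refl , refl) refl
      preserves (mid u _ _) (mid _ _ _) refl =
        sameColour-mids (mid↦ (mapped u) (refl , refl)) (mid↦ (mapped u) (refl , refl))

proposition9p2 : ∀ {n : ℕ} (G : Graph n) → 2 ≤ n → Connected G
    → ∃ (λ u → 3 ≤ deg G u)
    → (∀ (g : YV G ↔ YV G)
         → (∀ x y → YEdge G nothing x y ⇔ YEdge G nothing (Inverse.to g x) (Inverse.to g y))
         → ∀ x y → SameColor G x y → SameColor G (Inverse.to g x) (Inverse.to g y))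
      × (∀ (u₀ v₀ : Fin n) → Adj G u₀ v₀ → ∀ (g : YV G ↔ YV G)
         → (∀ x y → YEdge G (just (u₀ , v₀)) x y
                  ⇔ YEdge G (just (u₀ , v₀)) (Inverse.to g x) (Inverse.to g y))
         → ∀ x y → SameColor G x y → SameColor G (Inverse.to g x) (Inverse.to g y))
proposition9p2 G _ conn hub =
  (λ g hom → preserves-colour G nothing g hom conn hub) ,
  (λ u₀ v₀ _ g hom → preserves-colour G (just (u₀ , v₀)) g hom conn hub)
  where open Automorphism
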